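{- Let $\mathcal{B}$ be a connected set of pieces with concurrence relation $\mathcal{R}$. Then the number $|\mathbb{P}^{\beta}(\mathcal{B})|$ of full pyramids with maximal piece $\beta$ does not depend on $\beta\in\mathcal{B}$.
   Context: A set of pieces is a finite set $\mathcal{B}$ with a reflexive symmetric relation $\mathcal{R}$. $\mathcal{B}$ is connected if the graph on $\mathcal{B}$ joining distinct concurrent pieces is connected. A full heap on $\mathcal{B}$ is a partial order $\le$ on $\mathcal{B}$ such that (i) concurrent pieces are comparable, and (ii) whenever $y$ covers $x$, $x\mathcal{R}y$. A full pyramid is a full heap with a unique maximal element; $\mathbb{P}^{\beta}(\mathcal{B})$ is the set of full pyramids with maximal element $\beta$. -}

module Defs where

open import Data.Bool using (Bool; true; false; _≟_)
open import Data.Nat using (ℕ; zero; suc)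
open import Data.Fin using (Fin)
open import Data.Fin.Properties using (all?; any?) renaming (_≟_ to _≟ᶠ_)
open import Data.Vec using (Vec; []; _∷_; lookup)
open import Data.List using (List; []; _∷_; concatMap; map; filter; length)
open import Data.Product using (_×_; _,_; ∃)
open import Data.Sum using (_⊎_)
open import Relation.Nullary using (¬_; Dec; ¬?)
open import Relation.Nullary.Decidable using (_×-dec_; _⊎-dec_; _→-dec_)
open import Relation.Binary.PropositionalEquality using (_≡_; _≢_)

-- A set of pieces: the finite set Fin n with a Bool-valued relation R
-- (the concurrence relation), assumed reflexive and symmetric.

ConcRel : ℕ → Set
ConcRel n = Fin n → Fin n → Bool

_⟨_⟩_ : ∀ {n} → Fin n → ConcRel n → Fin n → Set
x ⟨ R ⟩ y = R x y ≡ true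

IsReflexive : ∀ {n} → ConcRel n → Set
IsReflexive {n} R = (x : Fin n) → x ⟨ R ⟩ x

IsSymmetric : ∀ {n} → ConcRel n → Set
IsSymmetric {n} R = (x y : Fin n) → x ⟨ R ⟩ y → y ⟨ R ⟩ x

data Path {n : ℕ} (R : ConcRel n) : Fin n → Fin n → Set where
  here : ∀ {x} → Path R x x
  step : ∀ {x y z} → x ≢ y → x ⟨ R ⟩ y → Path R y z → Path R x z

IsConnected : ∀ {n} → ConcRel n → Set
IsConnected {n} R = (x y : Fin n) → Path R x y

-- Binary relations on Fin n, represented as n×n Boolean matrices
-- (candidate orders  x ≤ y  iff  entry (x , y) is true).

Mat : ℕ → Set
Mat n = Vec (Vec Bool n) n

_≤[_]_ : ∀ {n} → Fin n → Mat n → Fin n → Set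
x ≤[ M ] y = lookup (lookup M x) y ≡ true

_<[_]_ : ∀ {n} → Fin n → Mat n → Fin n → Set
x <[ M ] y = x ≤[ M ] y × x ≢ y

Covers : ∀ {n} → Mat n → Fin n → Fin n → Set
Covers M x y = x <[ M ] y × ¬ ∃ (λ z → x <[ M ] z × z <[ M ] y)

IsPartialOrder : ∀ {n} → Mat n → Set
IsPartialOrder {n} M =
  ((x : Fin n) → x ≤[ M ] x) ×
  ((x y : Fin n) → x ≤[ M ] y → y ≤[ M ] x → x ≡ y) ×
  ((x y z : Fin n) → x ≤[ M ] y → y ≤[ M ] z → x ≤[ M ] z)

IsFullHeap : ∀ {n} → ConcRel n → Mat n → Set
IsFullHeap {n} R M =
  IsPartialOrder M ×
  ((x y : Fin n) → x ⟨ R ⟩ y → x ≤[ M ] y ⊎ y ≤[ M ] x) ×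
  ((x y : Fin n) → Covers M x y → x ⟨ R ⟩ y)

IsMaximal : ∀ {n} → Mat n → Fin n → Set
IsMaximal M x = ¬ ∃ (λ y → x <[ M ] y)

IsFullPyramid : ∀ {n} → ConcRel n → Fin n → Mat n → Set
IsFullPyramid {n} R β M =
  IsFullHeap R M × IsMaximal M β × ((x : Fin n) → IsMaximal M x → x ≡ β)

private
  ≤? : ∀ {n} (M : Mat n) (x y : Fin n) → Dec (x ≤[ M ] y)
  ≤? M x y = lookup (lookup M x) y ≟ true

  <? : ∀ {n} (M : Mat n) (x y : Fin n) → Dec (x <[ M ] y)
  <? M x y = ≤? M x y ×-dec ¬? (x ≟ᶠ y)

  R? : ∀ {n} (R : ConcRel n) (x y : Fin n) → Dec (x ⟨ R ⟩ y)
  R? R x y = R x y ≟ true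

  covers? : ∀ {n} (M : Mat n) (x y : Fin n) → Dec (Covers M x y)
  covers? M x y = <? M x y ×-dec ¬? (any? (λ z → <? M x z ×-dec <? M z y))

  po? : ∀ {n} (M : Mat n) → Dec (IsPartialOrder M)
  po? M = all? (λ x → ≤? M x x)
    ×-dec (all? λ x → all? λ y → ≤? M x y →-dec (≤? M y x →-dec (x ≟ᶠ y)))
    ×-dec (all? λ x → all? λ y → all? λ z → ≤? M x y →-dec (≤? M y z →-dec ≤? M x z))

  heap? : ∀ {n} (R : ConcRel n) (M : Mat n) → Dec (IsFullHeap R M)
  heap? R M = po? M
    ×-dec (all? λ x → all? λ y → R? R x y →-dec (≤? M x y ⊎-dec ≤? M y x))
    ×-dec (all? λ x → all? λ y → covers? M x y →-dec R? R x y)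

  max? : ∀ {n} (M : Mat n) (x : Fin n) → Dec (IsMaximal M x)
  max? M x = ¬? (any? (λ y → <? M x y))

isFullPyramid? : ∀ {n} (R : ConcRel n) (β : Fin n) (M : Mat n) → Dec (IsFullPyramid R β M)
isFullPyramid? R β M = heap? R M ×-dec max? M β ×-dec all? (λ x → max? M x →-dec (x ≟ᶠ β))

-- Explicit enumeration of all n×n Boolean matrices (each exactly once).

allVecs : ∀ {A : Set} → List A → (k : ℕ) → List (Vec A k)
allVecs xs zero = [] ∷ []
allVecs xs (suc k) = concatMap (λ a → map (a ∷_) (allVecs xs k)) xs

allMats : (n : ℕ) → List (Mat n)
allMats n = allVecs (allVecs (false ∷ true ∷ []) n) n

numFullPyramids : ∀ {n} → ConcRel n → Fin n → ℕ
numFullPyramids {n} R β = length (filter (isFullPyramid? R β) (allMats n))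

-- Let u and v be distinct concurrent pieces and M a full pyramid with top u.
-- Raising the down-set ↓v of M above all other pieces (keeping the order inside
-- ↓v and inside its complement, and putting x ∉ ↓v below y ∈ ↓v exactly when
-- some concurrent pair w R d with w ∉ ↓v ∋ d satisfies x ≤ w and d ≤ y) yields a
-- full pyramid with top v.  In the raised pyramid the down-set of u is the
-- complement of ↓v, and raising it gives back M.  So raising is injective on
-- pyramids with top u, whence |P^u| ≤ |P^v|; by symmetry the two counts are
-- equal, and connectivity propagates the equality along paths.
module Submission where

open import Defs
open import Data.Bool using (true; false) renaming (_≟_ to _≟ᵇ_)
open import Data.Bool.Properties using (⇔→≡)
open import Data.Empty using (⊥-elim)
open import Data.Fin using (Fin; _≟_)
open import Data.Fin.Induction using (po-wellFounded; po-noetherian)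
open import Data.Fin.Properties using (any?)
open import Data.List using (List; []; _∷_; _++_; map; concatMap; filter; length; cartesianProductWith)
open import Data.List.Membership.Propositional using (_∈_; _─_)
open import Data.List.Membership.Propositional.Properties using (∈-filter⁺; ∈-filter⁻; ∈-cartesianProductWith⁺)
open import Data.List.Properties using (length-removeAt′)
open import Data.List.Relation.Unary.All as All using ([]; _∷_)
open import Data.List.Relation.Unary.AllPairs using ([]; _∷_)
open import Data.List.Relation.Unary.Any using (here; there; index)
open import Data.List.Relation.Unary.Unique.Propositional using (Unique)
open import Data.List.Relation.Unary.Unique.Propositional.Properties using (cartesianProductWith⁺; filter⁺)
open import Data.Nat using (ℕ; zero; suc; _≤_; z≤n; s≤s)
import Data.Nat.Properties as ℕₚ
open import Data.Product using (_×_; _,_; ∃; ∃₂; proj₁; proj₂)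
open import Data.Sum as Sum using (_⊎_; inj₁; inj₂; swap)
open import Data.Vec using (Vec; []; _∷_; lookup; tabulate)
open import Data.Vec.Properties using (∷-injective; lookup∘tabulate)
open import Data.Vec.Relation.Binary.Pointwise.Extensional using (ext; Pointwise-≡⇒≡)
open import Function using (_∘_; const; id; case_of_; _⇔_; mk⇔)
open import Induction.WellFounded as WF using ()
open import Level using (0ℓ)
open import Relation.Binary.PropositionalEquality using (_≡_; _≢_; refl; sym; trans; cong; subst; isEquivalence; module ≡-Reasoning)
import Relation.Binary.Structures as Structures
open import Relation.Nullary using (¬_; Dec; yes; no; does; ¬?)
open import Relation.Nullary.Decidable using (_×-dec_; _⊎-dec_; _→-dec_; dec-true)
open import Relation.Unary using (Pred; Decidable)

∈-─ : ∀ {A : Set} {x z : A} {ys} (x∈ys : x ∈ ys) → z ∈ ys → z ≢ x → z ∈ ys ─ x∈ys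
∈-─ (here refl) (here refl) z≢x = ⊥-elim (z≢x refl)
∈-─ (here refl) (there z∈ys) _ = z∈ys
∈-─ (there x∈ys) (here refl) _ = here refl
∈-─ (there x∈ys) (there z∈ys) z≢x = there (∈-─ x∈ys z∈ys z≢x)

module _ {A B : Set} where

  length-≤-injection : ∀ {xs : List A} {ys : List B} (f : A → B) → Unique xs →
                       (∀ {x} → x ∈ xs → f x ∈ ys) →
                       (∀ {x y} → x ∈ xs → y ∈ xs → f x ≡ f y → x ≡ y) →
                       length xs ≤ length ys
  length-≤-injection {[]} f _ _ _ = z≤n
  length-≤-injection {x ∷ xs} {ys} f (x∉xs ∷ xs-unique) into inj = begin
      suc (length xs)           ≤⟨ s≤s (length-≤-injection f xs-unique into′ inj′) ⟩
      suc (length (ys ─ fx∈ys)) ≡⟨ length-removeAt′ ys (index fx∈ys) ⟨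
      length ys                 ∎
    where
      open ℕₚ.≤-Reasoning
      fx∈ys : f x ∈ ys
      fx∈ys = into (here refl)
      into′ : ∀ {z} → z ∈ xs → f z ∈ ys ─ fx∈ys
      into′ z∈xs = ∈-─ fx∈ys (into (there z∈xs))
                     (λ fz≡fx → All.lookup x∉xs z∈xs (inj (here refl) (there z∈xs) (sym fz≡fx)))
      inj′ : ∀ {y z} → y ∈ xs → z ∈ xs → f y ≡ f z → y ≡ z
      inj′ y∈xs z∈xs = inj (there y∈xs) (there z∈xs)

  count-≤-injection : ∀ {P : Pred A 0ℓ} {Q : Pred B 0ℓ} (P? : Decidable P) (Q? : Decidable Q)
                      {xs : List A} {ys : List B} → Unique xs → (∀ y → y ∈ ys) →
                      (f : A → B) → (∀ {x} → P x → Q (f x)) →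
                      (∀ {x y} → P x → P y → f x ≡ f y → x ≡ y) →
                      length (filter P? xs) ≤ length (filter Q? ys)
  count-≤-injection {P} P? Q? {xs} xs-unique complete f pres inj =
    length-≤-injection f (filter⁺ P? xs-unique)
      (λ x∈ → ∈-filter⁺ Q? (complete _) (pres (satisfies x∈)))
      (λ x∈ y∈ → inj (satisfies x∈) (satisfies y∈))
    where
      satisfies : ∀ {x} → x ∈ filter P? xs → P x
      satisfies x∈ = proj₂ (∈-filter⁻ P? {xs = xs} x∈)

module _ {A : Set} where

  concatMap-∷≡cartesianProductWith : ∀ {k} (xs : List A) (vs : List (Vec A k)) →
    concatMap (λ a → map (a ∷_) vs) xs ≡ cartesianProductWith _∷_ xs vs
  concatMap-∷≡cartesianProductWith []       vs = refl
  concatMap-∷≡cartesianProductWith (x ∷ xs) vs =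
    cong (map (x ∷_) vs ++_) (concatMap-∷≡cartesianProductWith xs vs)

  allVecs-unique : ∀ {xs : List A} → Unique xs → ∀ k → Unique (allVecs xs k)
  allVecs-unique xs-unique zero = [] ∷ []
  allVecs-unique {xs} xs-unique (suc k)
    rewrite concatMap-∷≡cartesianProductWith xs (allVecs xs k) =
    cartesianProductWith⁺ _∷_ ∷-injective xs-unique (allVecs-unique xs-unique k)

  ∈-allVecs : ∀ {xs : List A} → (∀ x → x ∈ xs) → ∀ {k} (v : Vec A k) → v ∈ allVecs xs k
  ∈-allVecs complete [] = here refl
  ∈-allVecs {xs} complete {suc k} (x ∷ v)
    rewrite concatMap-∷≡cartesianProductWith xs (allVecs xs k) =
    ∈-cartesianProductWith⁺ _∷_ (complete x) (∈-allVecs complete v)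

allBools-unique : Unique (false ∷ true ∷ [])
allBools-unique = ((λ ()) ∷ []) ∷ [] ∷ []

∈-allBools : ∀ b → b ∈ false ∷ true ∷ []
∈-allBools false = here refl
∈-allBools true  = there (here refl)

allMats-unique : ∀ n → Unique (allMats n)
allMats-unique n = allVecs-unique (allVecs-unique allBools-unique n) n

∈-allMats : ∀ {n} (M : Mat n) → M ∈ allMats n
∈-allMats M = ∈-allVecs (∈-allVecs ∈-allBools) M

_≤[_]?_ : ∀ {n} (x : Fin n) (M : Mat n) (y : Fin n) → Dec (x ≤[ M ] y)
x ≤[ M ]? y = lookup (lookup M x) y ≟ᵇ true

_<[_]?_ : ∀ {n} (x : Fin n) (M : Mat n) (y : Fin n) → Dec (x <[ M ] y)
x <[ M ]? y = x ≤[ M ]? y ×-dec ¬? (x ≟ y)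

Mat-ext : ∀ {n} {M N : Mat n} → (∀ x y → x ≤[ M ] y ⇔ x ≤[ N ] y) → M ≡ N
Mat-ext M⇔N = Pointwise-≡⇒≡ (ext λ x → Pointwise-≡⇒≡ (ext λ y → ⇔→≡ (M⇔N x y)))

module _ {n : ℕ} {_∼_ : Fin n → Fin n → Set} (_∼?_ : ∀ x y → Dec (x ∼ y)) where

  fromDec : Mat n
  fromDec = tabulate λ x → tabulate λ y → does (x ∼? y)

  lookup-fromDec : ∀ x y → lookup (lookup fromDec x) y ≡ does (x ∼? y)
  lookup-fromDec x y rewrite lookup∘tabulate (λ x → tabulate λ y → does (x ∼? y)) x =
    lookup∘tabulate (λ y → does (x ∼? y)) y

  fromDec⁺ : ∀ {x y} → x ∼ y → x ≤[ fromDec ] y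
  fromDec⁺ {x} {y} x∼y = trans (lookup-fromDec x y) (dec-true (x ∼? y) x∼y)

  fromDec⁻ : ∀ {x y} → x ≤[ fromDec ] y → x ∼ y
  fromDec⁻ {x} {y} x≤y with x ∼? y | lookup-fromDec x y
  ... | yes x∼y | _ = x∼y
  ... | no  _   | e = case (trans (sym e) x≤y) of λ ()

module FinitePoset {n : ℕ} (M : Mat n) (M-po : IsPartialOrder M) where

  ≤-refl : ∀ {x} → x ≤[ M ] x
  ≤-refl {x} = proj₁ M-po x

  ≤-antisym : ∀ {x y} → x ≤[ M ] y → y ≤[ M ] x → x ≡ y
  ≤-antisym {x} {y} = proj₁ (proj₂ M-po) x y

  ≤-trans : ∀ {x y z} → x ≤[ M ] y → y ≤[ M ] z → x ≤[ M ] z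
  ≤-trans {x} {y} {z} = proj₂ (proj₂ M-po) x y z

  isPartialOrder : Structures.IsPartialOrder _≡_ (_≤[ M ]_)
  isPartialOrder = record
    { isPreorder = record
      { isEquivalence = isEquivalence
      ; reflexive     = λ { refl → ≤-refl }
      ; trans         = ≤-trans
      }
    ; antisym = ≤-antisym
    }

  <-rec : (P : Pred (Fin n) 0ℓ) → (∀ y → (∀ {x} → x <[ M ] y → P x) → P y) → ∀ y → P y
  <-rec = WF.All.wfRec (po-wellFounded isPartialOrder) 0ℓ

  >-rec : (P : Pred (Fin n) 0ℓ) → (∀ x → (∀ {y} → x <[ M ] y → P y) → P x) → ∀ x → P x
  >-rec = WF.All.wfRec (po-noetherian isPartialOrder) 0ℓ

  cover-below : ∀ {x y} → x <[ M ] y → ∃ λ c → Covers M x c × c ≤[ M ] y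
  cover-below {x} {y} = <-rec (λ y → x <[ M ] y → ∃ λ c → Covers M x c × c ≤[ M ] y) go y
    where
      go : ∀ y → (∀ {z} → z <[ M ] y → x <[ M ] z → ∃ λ c → Covers M x c × c ≤[ M ] z) →
           x <[ M ] y → ∃ λ c → Covers M x c × c ≤[ M ] y
      go y ih x<y with any? (λ z → x <[ M ]? z ×-dec z <[ M ]? y)
      ... | no  nothing-between = y , (x<y , nothing-between) , ≤-refl
      ... | yes (z , x<z , z<y) with ih z<y x<z
      ...   | c , x⋖c , c≤z = c , x⋖c , ≤-trans c≤z (proj₁ z<y)

  cover-leaving : {D : Pred (Fin n) 0ℓ} → Decidable D → ∀ {x y} → x ≤[ M ] y → D x → ¬ D y →
                  ∃₂ λ w d → D w × ¬ D d × x ≤[ M ] w × Covers M w d × d ≤[ M ] y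
  cover-leaving {D} D? {x} = >-rec Leaving go x
    where
      Leaving : Pred (Fin n) 0ℓ
      Leaving x = ∀ {y} → x ≤[ M ] y → D x → ¬ D y →
                  ∃₂ λ w d → D w × ¬ D d × x ≤[ M ] w × Covers M w d × d ≤[ M ] y
      go : ∀ x → (∀ {c} → x <[ M ] c → Leaving c) → Leaving x
      go x ih x≤y Dx ¬Dy with cover-below (x≤y , λ { refl → ¬Dy Dx })
      ... | c , x⋖c , c≤y with D? c
      ...   | no  ¬Dc = x , c , Dx , ¬Dc , ≤-refl , x⋖c , c≤y
      ...   | yes Dc with ih (proj₁ x⋖c) c≤y Dc ¬Dy
      ...     | w , d , Dw , ¬Dd , c≤w , w⋖d , d≤y =
                w , d , Dw , ¬Dd , ≤-trans (proj₁ (proj₁ x⋖c)) c≤w , w⋖d , d≤y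

module _ {n : ℕ} {R : ConcRel n} (M : Mat n) where

  greatest-of-pyramid : ∀ {u} → IsFullPyramid R u M → ∀ x → x ≤[ M ] u
  greatest-of-pyramid {u} ((M-po , _) , _ , u-unique) = >-rec (_≤[ M ] u) go
    where
      open FinitePoset M M-po
      go : ∀ x → (∀ {y} → x <[ M ] y → y ≤[ M ] u) → x ≤[ M ] u
      go x ih with any? (x <[ M ]?_)
      ... | yes (y , x<y) = ≤-trans (proj₁ x<y) (ih x<y)
      ... | no  x-max     = subst (_≤[ M ] u) (sym (u-unique x x-max)) ≤-refl

  pyramid-of-greatest : ∀ {g} → IsFullHeap R M → (∀ x → x ≤[ M ] g) → IsFullPyramid R g M
  pyramid-of-greatest {g} heap@(M-po , _) greatest = heap , g-max , g-unique
    where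
      open FinitePoset M M-po
      g-max : IsMaximal M g
      g-max (y , g≤y , g≢y) = g≢y (≤-antisym g≤y (greatest y))
      g-unique : ∀ x → IsMaximal M x → x ≡ g
      g-unique x x-max with x ≟ g
      ... | yes x≡g = x≡g
      ... | no  x≢g = ⊥-elim (x-max (g , greatest x , x≢g))

-- Raising a down-set

module Raise {n : ℕ} (R : ConcRel n) (v : Fin n) (M : Mat n) where

  Below : Pred (Fin n) 0ℓ
  Below x = x ≤[ M ] v

  Bridge : Fin n → Fin n → Set
  Bridge x y = ∃₂ λ w d → ¬ Below w × Below d × x ≤[ M ] w × w ⟨ R ⟩ d × d ≤[ M ] y

  _⊑_ : Fin n → Fin n → Set
  x ⊑ y = (x ≤[ M ] y × (Below x → Below y)) ⊎ (¬ Below x × Below y × Bridge x y)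

  Below? : Decidable Below
  Below? x = x ≤[ M ]? v

  _⊑?_ : ∀ x y → Dec (x ⊑ y)
  x ⊑? y = (x ≤[ M ]? y ×-dec (Below? x →-dec Below? y))
        ⊎-dec (¬? (Below? x) ×-dec Below? y ×-dec any? λ w → any? λ d →
                 ¬? (Below? w) ×-dec Below? d ×-dec x ≤[ M ]? w ×-dec R w d ≟ᵇ true ×-dec d ≤[ M ]? y)

raise : ∀ {n} → ConcRel n → Fin n → Mat n → Mat n
raise R v M = fromDec (Raise._⊑?_ R v M)

module RaiseOfPyramid {n : ℕ} {R : ConcRel n} (R-sym : IsSymmetric R) {u v : Fin n} (M : Mat n)
                      (M-pyr : IsFullPyramid R u M) (uRv : u ⟨ R ⟩ v) (u≢v : u ≢ v) where

  open Raise R v M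
  open FinitePoset M (proj₁ (proj₁ M-pyr))

  private
    M-comparable : ∀ x y → x ⟨ R ⟩ y → x ≤[ M ] y ⊎ y ≤[ M ] x
    M-comparable = proj₁ (proj₂ (proj₁ M-pyr))

    M-cover-concurrent : ∀ x y → Covers M x y → x ⟨ R ⟩ y
    M-cover-concurrent = proj₂ (proj₂ (proj₁ M-pyr))

    ≤-top : ∀ x → x ≤[ M ] u
    ≤-top = greatest-of-pyramid M M-pyr

  P : Mat n
  P = raise R v M

  ⊑⇒≤P : ∀ {x y} → x ⊑ y → x ≤[ P ] y
  ⊑⇒≤P = fromDec⁺ _⊑?_

  ≤P⇒⊑ : ∀ {x y} → x ≤[ P ] y → x ⊑ y
  ≤P⇒⊑ = fromDec⁻ _⊑?_

  ¬Below-top : ¬ Below u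
  ¬Below-top u≤v = u≢v (≤-antisym u≤v (≤-top v))

  ¬Below-Below-≢ : ∀ {x y} → ¬ Below x → Below y → x ≢ y
  ¬Below-Below-≢ ¬Bx By refl = ¬Bx By

  ⊑⇒≤ : ∀ {x y} → x ⊑ y → ¬ (¬ Below x × Below y) → x ≤[ M ] y
  ⊑⇒≤ (inj₁ (x≤y , _))      _         = x≤y
  ⊑⇒≤ (inj₂ (¬Bx , By , _)) unbridged = ⊥-elim (unbridged (¬Bx , By))

  ⊑-antisym : ∀ {x y} → x ⊑ y → y ⊑ x → x ≡ y
  ⊑-antisym (inj₁ (x≤y , _)) (inj₁ (y≤x , _)) = ≤-antisym x≤y y≤x
  ⊑-antisym (inj₁ (_ , Bx⇒By)) (inj₂ (¬By , Bx , _)) = ⊥-elim (¬By (Bx⇒By Bx))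
  ⊑-antisym (inj₂ (¬Bx , By , _)) (inj₁ (_ , By⇒Bx)) = ⊥-elim (¬Bx (By⇒Bx By))
  ⊑-antisym (inj₂ (¬Bx , _)) (inj₂ (_ , Bx , _)) = ⊥-elim (¬Bx Bx)

  ⊑-trans : ∀ {x y z} → x ⊑ y → y ⊑ z → x ⊑ z
  ⊑-trans (inj₁ (x≤y , Bx⇒By)) (inj₁ (y≤z , By⇒Bz)) =
    inj₁ (≤-trans x≤y y≤z , By⇒Bz ∘ Bx⇒By)
  ⊑-trans (inj₁ (x≤y , Bx⇒By)) (inj₂ (¬By , Bz , w , d , ¬Bw , Bd , y≤w , wRd , d≤z)) =
    inj₂ (¬By ∘ Bx⇒By , Bz , w , d , ¬Bw , Bd , ≤-trans x≤y y≤w , wRd , d≤z)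
  ⊑-trans (inj₂ (¬Bx , By , w , d , ¬Bw , Bd , x≤w , wRd , d≤y)) (inj₁ (y≤z , By⇒Bz)) =
    inj₂ (¬Bx , By⇒Bz By , w , d , ¬Bw , Bd , x≤w , wRd , ≤-trans d≤y y≤z)
  ⊑-trans (inj₂ (_ , By , _)) (inj₂ (¬By , _)) = ⊥-elim (¬By By)

  ≤⇒⊑-comparable : ∀ {x y} → x ≤[ M ] y → x ⟨ R ⟩ y → x ⊑ y ⊎ y ⊑ x
  ≤⇒⊑-comparable {x} {y} x≤y xRy with Below? x | Below? y
  ... | yes Bx  | yes By  = inj₁ (inj₁ (x≤y , const By))
  ... | no  ¬Bx | no  _   = inj₁ (inj₁ (x≤y , ⊥-elim ∘ ¬Bx))
  ... | no  ¬Bx | yes By  = ⊥-elim (¬Bx (≤-trans x≤y By))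
  ... | yes Bx  | no  ¬By =
          inj₂ (inj₂ (¬By , Bx , y , x , ¬By , Bx , ≤-refl , R-sym x y xRy , ≤-refl))

  ⊑-comparable : ∀ x y → x ⟨ R ⟩ y → x ⊑ y ⊎ y ⊑ x
  ⊑-comparable x y xRy with M-comparable x y xRy
  ... | inj₁ x≤y = ≤⇒⊑-comparable x≤y xRy
  ... | inj₂ y≤x = swap (≤⇒⊑-comparable y≤x (R-sym x y xRy))

  not-covered : ∀ {x y} z → x ⊑ z → z ⊑ y → x ≢ z → z ≢ y → ¬ Covers P x y
  not-covered z x⊑z z⊑y x≢z z≢y (_ , nothing-between) =
    nothing-between (z , (⊑⇒≤P x⊑z , x≢z) , (⊑⇒≤P z⊑y , z≢y))

  P-cover-concurrent : ∀ x y → Covers P x y → x ⟨ R ⟩ y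
  P-cover-concurrent x y x⋖y@((x≤Py , x≢y) , _) with ≤P⇒⊑ x≤Py
  ... | inj₁ (x≤y , Bx⇒By) = M-cover-concurrent x y ((x≤y , x≢y) , λ where
        (z , (x≤z , x≢z) , (z≤y , z≢y)) →
          not-covered z (inj₁ (x≤z , ≤-trans z≤y ∘ Bx⇒By))
                        (inj₁ (z≤y , Bx⇒By ∘ ≤-trans x≤z)) x≢z z≢y x⋖y)
  ... | inj₂ (¬Bx , By , w , d , ¬Bw , Bd , x≤w , wRd , d≤y) with x ≟ w | d ≟ y
  ...   | yes refl | yes refl = wRd
  ...   | no  x≢w  | _        =
          ⊥-elim (not-covered w (inj₁ (x≤w , ⊥-elim ∘ ¬Bx))
                                (inj₂ (¬Bw , By , w , d , ¬Bw , Bd , ≤-refl , wRd , d≤y))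
                                x≢w (¬Below-Below-≢ ¬Bw By) x⋖y)
  ...   | yes refl | no  d≢y  =
          ⊥-elim (not-covered d (inj₂ (¬Bx , Bd , x , d , ¬Bx , Bd , ≤-refl , wRd , ≤-refl))
                                (inj₁ (d≤y , const By))
                                (¬Below-Below-≢ ¬Bx Bd) d≢y x⋖y)

  ⊑-greatest : ∀ x → x ⊑ v
  ⊑-greatest x with Below? x
  ... | yes Bx  = inj₁ (Bx , const ≤-refl)
  ... | no  ¬Bx = inj₂ (¬Bx , ≤-refl , u , v , ¬Below-top , ≤-refl , ≤-top x , uRv , ≤-refl)

  raise-isFullPyramid : IsFullPyramid R v P
  raise-isFullPyramid =
    pyramid-of-greatest P (P-po , P-comparable , P-cover-concurrent) (⊑⇒≤P ∘ ⊑-greatest)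
    where
      P-po : IsPartialOrder P
      P-po = (λ x → ⊑⇒≤P (inj₁ (≤-refl , id)))
           , (λ x y x≤y y≤x → ⊑-antisym (≤P⇒⊑ x≤y) (≤P⇒⊑ y≤x))
           , (λ x y z x≤y y≤z → ⊑⇒≤P (⊑-trans (≤P⇒⊑ x≤y) (≤P⇒⊑ y≤z)))
      P-comparable : ∀ x y → x ⟨ R ⟩ y → x ≤[ P ] y ⊎ y ≤[ P ] x
      P-comparable x y xRy = Sum.map ⊑⇒≤P ⊑⇒≤P (⊑-comparable x y xRy)

  Below-⊑-upward : ∀ {x y} → x ⊑ y → Below x → Below y
  Below-⊑-upward (inj₁ (_ , Bx⇒By)) = Bx⇒By
  Below-⊑-upward (inj₂ (¬Bx , _))   = ⊥-elim ∘ ¬Bx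

  open Raise R u P using () renaming (Below to Below′; _⊑_ to _⊑′_; _⊑?_ to _⊑′?_)

  Below′⇒¬Below : ∀ {x} → Below′ x → ¬ Below x
  Below′⇒¬Below x≤Pu Bx = ¬Below-top (Below-⊑-upward (≤P⇒⊑ x≤Pu) Bx)

  ¬Below⇒Below′ : ∀ {x} → ¬ Below x → Below′ x
  ¬Below⇒Below′ {x} ¬Bx = ⊑⇒≤P (inj₁ (≤-top x , ⊥-elim ∘ ¬Bx))

  ¬Below′⇒Below : ∀ {x} → ¬ Below′ x → Below x
  ¬Below′⇒Below {x} ¬B′x with Below? x
  ... | yes Bx  = Bx
  ... | no  ¬Bx = ⊥-elim (¬B′x (¬Below⇒Below′ ¬Bx))

  ⊑′⇒≤ : ∀ {x y} → x ⊑′ y → x ≤[ M ] y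
  ⊑′⇒≤ (inj₁ (x≤Py , B′x⇒B′y)) =
    ⊑⇒≤ (≤P⇒⊑ x≤Py) λ (¬Bx , By) → Below′⇒¬Below (B′x⇒B′y (¬Below⇒Below′ ¬Bx)) By
  ⊑′⇒≤ {x} {y} (inj₂ (¬B′x , B′y , w , d , ¬B′w , B′d , x≤Pw , wRd , d≤Py)) =
    ≤-trans x≤w (≤-trans w≤d d≤y)
    where
      x≤w : x ≤[ M ] w
      x≤w = ⊑⇒≤ (≤P⇒⊑ x≤Pw) λ (¬Bx , _) → ¬Bx (¬Below′⇒Below ¬B′x)
      d≤y : d ≤[ M ] y
      d≤y = ⊑⇒≤ (≤P⇒⊑ d≤Py) λ (_ , By) → Below′⇒¬Below B′y By
      w≤d : w ≤[ M ] d
      w≤d with M-comparable w d wRd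
      ... | inj₁ w≤d = w≤d
      ... | inj₂ d≤w = ⊥-elim (Below′⇒¬Below B′d (≤-trans d≤w (¬Below′⇒Below ¬B′w)))

  ≤⇒⊑′ : ∀ {x y} → x ≤[ M ] y → x ⊑′ y
  ≤⇒⊑′ {x} {y} x≤y with Below? x | Below? y
  ... | yes Bx  | yes By  =
          inj₁ (⊑⇒≤P (inj₁ (x≤y , const By)) , λ B′x → ⊥-elim (Below′⇒¬Below B′x Bx))
  ... | no  ¬Bx | no  ¬By =
          inj₁ (⊑⇒≤P (inj₁ (x≤y , ⊥-elim ∘ ¬Bx)) , const (¬Below⇒Below′ ¬By))
  ... | no  ¬Bx | yes By  = ⊥-elim (¬Bx (≤-trans x≤y By))
  ... | yes Bx  | no  ¬By with cover-leaving Below? x≤y Bx ¬By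
  ...   | w , d , Bw , ¬Bd , x≤w , w⋖d , d≤y =
          inj₂ ( (λ B′x → Below′⇒¬Below B′x Bx) , ¬Below⇒Below′ ¬By , w , d
               , (λ B′w → Below′⇒¬Below B′w Bw) , ¬Below⇒Below′ ¬Bd
               , ⊑⇒≤P (inj₁ (x≤w , const Bw)) , M-cover-concurrent w d w⋖d
               , ⊑⇒≤P (inj₁ (d≤y , ⊥-elim ∘ ¬Bd)) )

  raise-raise : raise R u P ≡ M
  raise-raise = Mat-ext λ x y → mk⇔ (⊑′⇒≤ ∘ fromDec⁻ _⊑′?_) (fromDec⁺ _⊑′?_ ∘ ≤⇒⊑′)

module _ {n : ℕ} {R : ConcRel n} (R-sym : IsSymmetric R) where

  numFullPyramids-≤-concurrent : ∀ {u v} → u ⟨ R ⟩ v → u ≢ v →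
                                 numFullPyramids R u ≤ numFullPyramids R v
  numFullPyramids-≤-concurrent {u} {v} uRv u≢v =
    count-≤-injection (isFullPyramid? R u) (isFullPyramid? R v) (allMats-unique n) ∈-allMats
      (raise R v) (λ {M} M-pyr → RaiseOfPyramid.raise-isFullPyramid R-sym M M-pyr uRv u≢v)
      raise-injective
    where
      raise-injective : ∀ {M N} → IsFullPyramid R u M → IsFullPyramid R u N →
                        raise R v M ≡ raise R v N → M ≡ N
      raise-injective {M} {N} M-pyr N-pyr eq = begin
        M                       ≡⟨ RaiseOfPyramid.raise-raise R-sym M M-pyr uRv u≢v ⟨
        raise R u (raise R v M) ≡⟨ cong (raise R u) eq ⟩
        raise R u (raise R v N) ≡⟨ RaiseOfPyramid.raise-raise R-sym N N-pyr uRv u≢v ⟩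
        N                       ∎
        where open ≡-Reasoning

  numFullPyramids-path : ∀ {x y} → Path R x y → numFullPyramids R x ≡ numFullPyramids R y
  numFullPyramids-path here = refl
  numFullPyramids-path (step {x} {y} x≢y xRy y⇝z) =
    trans (ℕₚ.≤-antisym (numFullPyramids-≤-concurrent xRy x≢y)
                        (numFullPyramids-≤-concurrent (R-sym x y xRy) (x≢y ∘ sym)))
          (numFullPyramids-path y⇝z)

corollary2p15 : (n : ℕ) (R : ConcRel n) → IsReflexive R → IsSymmetric R → IsConnected R →
                (β β′ : Fin n) → numFullPyramids R β ≡ numFullPyramids R β′
corollary2p15 n R _ R-sym connected β β′ = numFullPyramids-path R-sym (connected β β′)
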